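{- Let $G$ be a finite graph with minimum degree at least $3$. If the edges of $G$ are colored (not necessarily properly) using $\ell\ge 3$ colors, then there exists a cycle in $G$ containing no edge of the least frequent color (a color appearing on the fewest edges, possibly on none).
   Context: Graphs may have multiple edges but no loops. A cycle is a connected 2-regular subgraph (in particular two parallel edges form a cycle). -}

module Defs where

open import Data.Nat using (ℕ; zero; suc; _+_; _≤_)
open import Data.Fin using (Fin; zero; suc; _≟_)
open import Data.Bool using (Bool; true; false; _∧_; _∨_)
open import Data.Product using (_×_; _,_; proj₁; proj₂; ∃)
open import Data.Sum using (_⊎_)
open import Relation.Nullary.Decidable using (⌊_⌋)
open import Relation.Binary.PropositionalEquality using (_≡_; _≢_)

b2n : Bool → ℕ
b2n true  = 1
b2n false = 0

count : {k : ℕ} → (Fin k → Bool) → ℕ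
count {zero}  P = 0
count {suc k} P = b2n (P zero) + count (λ i → P (suc i))

-- A finite multigraph without loops: vertices Fin n, edges Fin m,
-- each edge has two distinct endpoints (parallel edges allowed).
record Graph : Set where
  field
    n     : ℕ
    m     : ℕ
    ends  : Fin m → Fin n × Fin n
    noLoop : (e : Fin m) → proj₁ (ends e) ≢ proj₂ (ends e)

module _ (G : Graph) where
  open Graph G

  incident : Fin n → Fin m → Bool
  incident v e = ⌊ v ≟ proj₁ (ends e) ⌋ ∨ ⌊ v ≟ proj₂ (ends e) ⌋

  degree : Fin n → ℕ
  degree v = count (incident v)

  minDegreeAtLeast : ℕ → Set
  minDegreeAtLeast d = (v : Fin n) → d ≤ degree v

  EdgeSet : Set
  EdgeSet = Fin m → Bool

  degreeIn : EdgeSet → Fin n → ℕ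
  degreeIn S v = count (λ e → S e ∧ incident v e)

  Joins : Fin m → Fin n → Fin n → Set
  Joins e u w = ends e ≡ (u , w) ⊎ ends e ≡ (w , u)

  data Walk (S : EdgeSet) : Fin n → Fin n → Set where
    here : ∀ {u} → Walk S u u
    step : ∀ {u w v} (e : Fin m) → S e ≡ true → Joins e u w → Walk S w v → Walk S u v

  -- vertex set of the subgraph formed by S: vertices incident to an edge of S
  -- A cycle: a nonempty connected 2-regular subgraph.
  IsCycle : EdgeSet → Set
  IsCycle S =
      (∃ λ e → S e ≡ true)
    × ((v : Fin n) → degreeIn S v ≡ 0 ⊎ degreeIn S v ≡ 2)
    × ((u v : Fin n) → degreeIn S u ≢ 0 → degreeIn S v ≢ 0 → Walk S u v)

  module _ {ℓ : ℕ} (c : Fin m → Fin ℓ) where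
    colorCount : Fin ℓ → ℕ
    colorCount k = count (λ e → ⌊ c e ≟ k ⌋)

    LeastFrequent : Fin ℓ → Set
    LeastFrequent k = (k′ : Fin ℓ) → colorCount k ≤ colorCount k′

    Avoids : EdgeSet → Fin ℓ → Set
    Avoids S k = (e : Fin m) → S e ≡ true → c e ≢ k

-- Let T be the set of edges whose colour is not k. The rarest of ℓ ≥ 3 colours occurs on at most
-- m/3 edges, while the handshake lemma and minimum degree 3 give 3n ≤ 2m; so T has at least n edges.
-- A nonempty edge set with no more non-isolated vertices than edges contains a cycle: deleting the
-- edge at a vertex of degree 1 preserves this inequality and cannot empty the set, since a single
-- edge has two ends. Once no vertex has degree 1, a path can always leave its head along an unused
-- edge, so it grows until it meets one of its own vertices and closes a cycle.

module Submission where

open import Algebra.Bundles using (CommutativeMonoid)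
open import Data.Bool using (Bool; true; false; _∧_; _∨_; not)
open import Data.Bool.Properties
  using (∧-commutativeMonoid; ∧-distribʳ-∨; ∨-comm; ∨-zeroʳ; ∧-zeroʳ; ¬-not)
open import Data.Empty using (⊥-elim)
open import Data.Fin using (Fin; zero; suc; _≟_)
open import Data.Fin.Properties using (any?; 0≢1+n)
import Data.Fin.Properties as Fin
open import Data.Nat using (ℕ; zero; suc; _+_; _*_; _≤_; _<_; _<ᵇ_; z≤n; s≤s)
open import Data.Nat.Induction using (<-wellFounded)
open import Data.Nat.Properties
  using ( ≤-refl; ≤-trans; ≤-reflexive; ≤-pred; <⇒≱; m≤n+m; suc-injective
        ; +-suc; +-identityʳ; +-mono-≤; +-monoʳ-≤; +-cancelʳ-≤
        ; *-monoˡ-≤; *-cancelʳ-≤; *-distribʳ-+; *-distribˡ-+; *-identityʳ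
        ; +-0-commutativeMonoid; module ≤-Reasoning)
  renaming (_≟_ to _≟ℕ_)
open import Data.Nat.Tactic.RingSolver using (solve-∀)
open import Data.Product using (Σ; ∃; _×_; _,_; proj₁; proj₂)
open import Data.Sum using (_⊎_; inj₁; inj₂)
open import Data.Unit using (⊤; tt)
open import Function using (_∘_; case_of_)
open import Induction.WellFounded using (Acc; acc)
open import Relation.Nullary using (yes; no)
open import Relation.Nullary.Decidable using (⌊_⌋; isYes≗does; dec-true; dec-false)
open import Relation.Binary.PropositionalEquality
  using (_≡_; _≢_; refl; sym; trans; cong; cong₂; subst; ≢-sym; module ≡-Reasoning)

open import Algebra.Properties.CommutativeMonoid.Sum +-0-commutativeMonoid
  using (sum; ∑-comm; ∑-distrib-+; sum-cong-≗)
open import Algebra.Properties.CommutativeSemigroup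
  (CommutativeMonoid.commutativeSemigroup ∧-commutativeMonoid) using (xy∙z≈xz∙y)

open import Defs

private variable
  a b k : ℕ
  i j : Fin k
  P Q R : Fin k → Bool

⌊≟⌋-refl : (i : Fin k) → ⌊ i ≟ i ⌋ ≡ true
⌊≟⌋-refl i = trans (isYes≗does (i ≟ i)) (dec-true (i ≟ i) refl)

⌊≟⌋-≢ : i ≢ j → ⌊ i ≟ j ⌋ ≡ false
⌊≟⌋-≢ {i = i} {j} i≢j = trans (isYes≗does (i ≟ j)) (dec-false (i ≟ j) i≢j)

⌊≟⌋⇒≡ : ⌊ i ≟ j ⌋ ≡ true → i ≡ j
⌊≟⌋⇒≡ {i = i} {j} _  with i ≟ j
⌊≟⌋⇒≡ _  | yes i≡j = i≡j
⌊≟⌋⇒≡ () | no _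

∧-elim : ∀ {x y} → x ∧ y ≡ true → x ≡ true × y ≡ true
∧-elim {true} y≡true = refl , y≡true

b2n-∨ : ∀ {x y} → (x ≡ true → y ≡ false) → b2n (x ∨ y) ≡ b2n x + b2n y
b2n-∨ {true}  disjoint rewrite disjoint refl = refl
b2n-∨ {false} _ = refl

b2n-mono : ∀ {x y} → (x ≡ true → y ≡ true) → b2n x ≤ b2n y
b2n-mono {false} _ = z≤n
b2n-mono {true}  x⇒y rewrite x⇒y refl = ≤-refl

_⊆_ : {A : Set} → (A → Bool) → (A → Bool) → Set
P ⊆ Q = ∀ x → P x ≡ true → Q x ≡ true

⊆-trans : P ⊆ Q → Q ⊆ R → P ⊆ R
⊆-trans P⊆Q Q⊆R x = Q⊆R x ∘ P⊆Q x

⊆-false : P ⊆ Q → Q i ≡ false → P i ≡ false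
⊆-false {i = i} P⊆Q Qi = ¬-not λ Pi → case trans (sym (P⊆Q i Pi)) Qi of λ ()

Nonempty : {A : Set} → (A → Bool) → Set
Nonempty P = ∃ λ x → P x ≡ true

insert : Fin k → (Fin k → Bool) → Fin k → Bool
insert j P i = ⌊ i ≟ j ⌋ ∨ P i

insert-∋ : (j : Fin k) (P : Fin k → Bool) → insert j P j ≡ true
insert-∋ j P = cong (_∨ P j) (⌊≟⌋-refl j)

insert-⊇ : P ⊆ insert j P
insert-⊇ {j = j} i Pi = trans (cong (⌊ i ≟ j ⌋ ∨_) Pi) (∨-zeroʳ _)

insert⁻ : i ≢ j → insert j P i ≡ true → P i ≡ true
insert⁻ {i = i} {P = P} i≢j = trans (cong (_∨ P i) (sym (⌊≟⌋-≢ i≢j)))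

insert-mono : P ⊆ Q → insert j P ⊆ insert j Q
insert-mono {j = j} P⊆Q i h with ⌊ i ≟ j ⌋
... | true  = refl
... | false = P⊆Q i h

_─_ : (Fin k → Bool) → Fin k → Fin k → Bool
(P ─ j) i = P i ∧ not ⌊ i ≟ j ⌋

─-⊆ : (P ─ j) ⊆ P
─-⊆ _ = proj₁ ∘ ∧-elim

─-∋ : (P : Fin k → Bool) → P i ≡ true → i ≢ j → (P ─ j) i ≡ true
─-∋ _ Pi i≢j = cong₂ _∧_ Pi (cong not (⌊≟⌋-≢ i≢j))

─-elim : (P ─ j) i ≡ true → P i ≡ true × i ≢ j
─-elim {i = i} h with ∧-elim h
... | Pi , ¬i≟j = Pi , λ { refl → case trans (sym ¬i≟j) (cong not (⌊≟⌋-refl i)) of λ () }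

count≡sum : (P : Fin k → Bool) → count P ≡ sum (b2n ∘ P)
count≡sum {zero}  P = refl
count≡sum {suc k} P = cong (b2n (P zero) +_) (count≡sum (P ∘ suc))

count-cong : (∀ i → P i ≡ Q i) → count P ≡ count Q
count-cong {zero}  _   = refl
count-cong {suc k} P≗Q = cong₂ _+_ (cong b2n (P≗Q zero)) (count-cong (P≗Q ∘ suc))

count-mono : P ⊆ Q → count P ≤ count Q
count-mono {zero}  _   = z≤n
count-mono {suc k} P⊆Q = +-mono-≤ (b2n-mono (P⊆Q zero)) (count-mono (P⊆Q ∘ suc))

count≤ : (P : Fin k → Bool) → count P ≤ k
count≤ {zero}  P = z≤n
count≤ {suc k} P with P zero
... | true  = s≤s (count≤ (P ∘ suc))
... | false = ≤-trans (count≤ (P ∘ suc)) (m≤n+m k 1)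

count-none : (∀ i → P i ≡ false) → count P ≡ 0
count-none {zero}  _    = refl
count-none {suc k} none rewrite none zero = count-none (none ∘ suc)

count-witness : count P ≢ 0 → Nonempty P
count-witness {zero}  count≢0 = ⊥-elim (count≢0 refl)
count-witness {suc k} {P} count≢0 with P zero in P0
... | true  = zero , P0
... | false with count-witness count≢0
...   | i , Pi = suc i , Pi

count-complement : (P : Fin k → Bool) → count (not ∘ P) + count P ≡ k
count-complement {zero}  P = refl
count-complement {suc k} P with P zero
... | true  = trans (+-suc _ _) (cong suc (count-complement (P ∘ suc)))
... | false = cong suc (count-complement (P ∘ suc))

count-∨ : (P Q : Fin k → Bool) → (∀ i → P i ≡ true → Q i ≡ false) →
          count (λ i → P i ∨ Q i) ≡ count P + count Q
count-∨ P Q disjoint = begin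
  count (λ i → P i ∨ Q i)            ≡⟨ count≡sum (λ i → P i ∨ Q i) ⟩
  sum (λ i → b2n (P i ∨ Q i))        ≡⟨ sum-cong-≗ (λ i → b2n-∨ (disjoint i)) ⟩
  sum (λ i → b2n (P i) + b2n (Q i))  ≡⟨ ∑-distrib-+ (b2n ∘ P) (b2n ∘ Q) ⟩
  sum (b2n ∘ P) + sum (b2n ∘ Q)      ≡⟨ cong₂ _+_ (count≡sum P) (count≡sum Q) ⟨
  count P + count Q                  ∎
  where open ≡-Reasoning

count-unique : (P : Fin k → Bool) (j : Fin k) → (∀ i → P i ≡ true → i ≡ j) →
               count P ≡ b2n (P j)
count-unique {suc k} P zero only =
  trans (cong (b2n (P zero) +_) (count-none λ i → ¬-not (0≢1+n ∘ sym ∘ only (suc i))))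
        (+-identityʳ _)
count-unique {suc k} P (suc j) only rewrite ¬-not {P zero} (0≢1+n ∘ only zero) =
  count-unique (P ∘ suc) j (λ i → Fin.suc-injective ∘ only (suc i))

count-≟ʳ : (j : Fin k) → count (λ i → ⌊ i ≟ j ⌋) ≡ 1
count-≟ʳ j = trans (count-unique _ j (λ _ → ⌊≟⌋⇒≡)) (cong b2n (⌊≟⌋-refl j))

count-≟ˡ : (j : Fin k) → count (λ i → ⌊ j ≟ i ⌋) ≡ 1
count-≟ˡ j = trans (count-unique _ j (λ _ → sym ∘ ⌊≟⌋⇒≡)) (cong b2n (⌊≟⌋-refl j))

count-≟∧ : (j : Fin k) (Q : Fin k → Bool) → count (λ i → ⌊ i ≟ j ⌋ ∧ Q i) ≡ b2n (Q j)
count-≟∧ j Q = trans (count-unique _ j (λ _ → ⌊≟⌋⇒≡ ∘ proj₁ ∘ ∧-elim))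
                     (cong (λ x → b2n (x ∧ Q j)) (⌊≟⌋-refl j))

count-insert-∧ : (Q : Fin k → Bool) → P j ≡ false →
                 count (λ i → insert j P i ∧ Q i) ≡ b2n (Q j) + count (λ i → P i ∧ Q i)
count-insert-∧ {P = P} {j} Q Pj = begin
  count (λ i → (⌊ i ≟ j ⌋ ∨ P i) ∧ Q i)
    ≡⟨ count-cong (λ i → ∧-distribʳ-∨ (Q i) _ (P i)) ⟩
  count (λ i → (⌊ i ≟ j ⌋ ∧ Q i) ∨ (P i ∧ Q i))
    ≡⟨ count-∨ _ _ disjoint ⟩
  count (λ i → ⌊ i ≟ j ⌋ ∧ Q i) + count (λ i → P i ∧ Q i)
    ≡⟨ cong (_+ _) (count-≟∧ j Q) ⟩
  b2n (Q j) + count (λ i → P i ∧ Q i)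
    ∎
  where
  open ≡-Reasoning
  disjoint : ∀ i → ⌊ i ≟ j ⌋ ∧ Q i ≡ true → P i ∧ Q i ≡ false
  disjoint i h = cong (_∧ Q i) (trans (cong P (⌊≟⌋⇒≡ (proj₁ (∧-elim h)))) Pj)

count-insert : (P : Fin k → Bool) → P j ≡ false → count (insert j P) ≡ suc (count P)
count-insert {j = j} P Pj =
  trans (count-∨ _ P λ i i≟j → trans (cong P (⌊≟⌋⇒≡ i≟j)) Pj)
        (cong (_+ count P) (count-≟ʳ j))

count-remove : (P : Fin k → Bool) → P j ≡ true → count P ≡ suc (count (P ─ j))
count-remove {j = j} P Pj = begin
  count P
    ≡⟨ count-cong split ⟩
  count (λ i → (⌊ i ≟ j ⌋ ∧ P i) ∨ (P ─ j) i)
    ≡⟨ count-∨ _ (P ─ j) disjoint ⟩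
  count (λ i → ⌊ i ≟ j ⌋ ∧ P i) + count (P ─ j)
    ≡⟨ cong (_+ count (P ─ j)) (count-≟∧ j P) ⟩
  b2n (P j) + count (P ─ j)
    ≡⟨ cong (λ x → b2n x + count (P ─ j)) Pj ⟩
  suc (count (P ─ j))
    ∎
  where
  open ≡-Reasoning
  split : ∀ i → P i ≡ (⌊ i ≟ j ⌋ ∧ P i) ∨ (P ─ j) i
  split i with ⌊ i ≟ j ⌋ | P i
  ... | true  | true  = refl
  ... | true  | false = refl
  ... | false | true  = refl
  ... | false | false = refl
  disjoint : ∀ i → ⌊ i ≟ j ⌋ ∧ P i ≡ true → (P ─ j) i ≡ false
  disjoint i h = trans (cong (λ x → P i ∧ not x) (proj₁ (∧-elim h))) (∧-zeroʳ (P i))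

count-pos : (P : Fin k → Bool) → P j ≡ true → 0 < count P
count-pos P Pj rewrite count-remove P Pj = s≤s z≤n

count-≥2 : (P : Fin k → Bool) → P i ≡ true → P j ≡ true → i ≢ j → 2 ≤ count P
count-≥2 {i = i} P Pi Pj i≢j rewrite count-remove P Pi =
  s≤s (count-pos (P ─ i) (─-∋ P Pj (i≢j ∘ sym)))

count-< : P ⊆ Q → P j ≡ false → Q j ≡ true → count P < count Q
count-< {P = P} {Q} {j} P⊆Q Pj Qj rewrite count-remove Q Qj = s≤s (count-mono P⊆Q─j)
  where
  P⊆Q─j : P ⊆ (Q ─ j)
  P⊆Q─j i Pi = ─-∋ Q (P⊆Q i Pi) λ { refl → case trans (sym Pi) Pj of λ () }

sum-const : (c : ℕ) → sum {k} (λ _ → c) ≡ k * c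
sum-const {zero}  c = refl
sum-const {suc k} c = cong (c +_) (sum-const {k} c)

sum-mono : {f g : Fin k → ℕ} → (∀ i → f i ≤ g i) → sum f ≤ sum g
sum-mono {zero}  _   = z≤n
sum-mono {suc k} f≤g = +-mono-≤ (f≤g zero) (sum-mono (f≤g ∘ suc))

double-counting : (R : Fin a → Fin b → Bool) {c : ℕ} → (∀ j → count (λ i → R i j) ≡ c) →
                  sum (λ i → count (R i)) ≡ b * c
double-counting {b = b} R {c} columns = begin
  sum (λ i → count (R i))              ≡⟨ sum-cong-≗ (λ i → count≡sum (R i)) ⟩
  sum (λ i → sum (λ j → b2n (R i j)))  ≡⟨ ∑-comm (λ i j → b2n (R i j)) ⟩
  sum (λ j → sum (λ i → b2n (R i j)))  ≡⟨ sum-cong-≗ (λ j → count≡sum (λ i → R i j)) ⟨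
  sum (λ j → count (λ i → R i j))      ≡⟨ sum-cong-≗ columns ⟩
  sum {b} (λ _ → c)                    ≡⟨ sum-const {b} c ⟩
  b * c                                ∎
  where open ≡-Reasoning

3n≤2m⇒3c≤m⇒n≤m-c : ∀ {n m c t} → n * 3 ≤ m * 2 → 3 * c ≤ m → t + c ≡ m → n ≤ t
3n≤2m⇒3c≤m⇒n≤m-c {n} {c = c} {t} 3n≤2m 3c≤m refl = *-cancelʳ-≤ n t 3 (begin
  n * 3           ≤⟨ 3n≤2m ⟩
  (t + c) * 2     ≡⟨ *-distribʳ-+ 2 t c ⟩
  t * 2 + c * 2   ≤⟨ +-monoʳ-≤ (t * 2) 2c≤t ⟩
  t * 2 + t       ≡⟨ x*2+x≡x*3 t ⟩
  t * 3           ∎)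
  where
  open ≤-Reasoning
  x*2+x≡x*3 : ∀ x → x * 2 + x ≡ x * 3
  x*2+x≡x*3 = solve-∀
  x*2+x≡3*x : ∀ x → x * 2 + x ≡ 3 * x
  x*2+x≡3*x = solve-∀
  2c≤t : c * 2 ≤ t
  2c≤t = +-cancelʳ-≤ c (c * 2) t (subst (_≤ t + c) (sym (x*2+x≡3*x c)) 3c≤m)

0<ᵇ-mono : a ≤ b → (0 <ᵇ a) ≡ true → (0 <ᵇ b) ≡ true
0<ᵇ-mono {suc a} (s≤s _) _ = refl

0<⇒0<ᵇ : 0 < a → (0 <ᵇ a) ≡ true
0<⇒0<ᵇ (s≤s _) = refl

module _ (G : Graph) where
  open Graph G

  private variable
    u v w x y z : Fin n
    e : Fin m
    S T : EdgeSet G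

  Joins-sym : Joins G e u w → Joins G e w u
  Joins-sym (inj₁ eq) = inj₂ eq
  Joins-sym (inj₂ eq) = inj₁ eq

  joins-distinct : Joins G e u w → u ≢ w
  joins-distinct {e} (inj₁ eq) = subst (λ (p : Fin n × Fin n) → proj₁ p ≢ proj₂ p) eq (noLoop e)
  joins-distinct {e} (inj₂ eq) =
    ≢-sym (subst (λ (p : Fin n × Fin n) → proj₁ p ≢ proj₂ p) eq (noLoop e))

  incident-joins : Joins G e u w → ∀ x → incident G x e ≡ ⌊ x ≟ u ⌋ ∨ ⌊ x ≟ w ⌋
  incident-joins (inj₁ eq) x =
    cong (λ (p : Fin n × Fin n) → ⌊ x ≟ proj₁ p ⌋ ∨ ⌊ x ≟ proj₂ p ⌋) eq
  incident-joins {u = u} {w = w} (inj₂ eq) x =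
    trans (incident-joins (inj₁ eq) x) (∨-comm ⌊ x ≟ w ⌋ ⌊ x ≟ u ⌋)

  incident-start : Joins G e u w → incident G u e ≡ true
  incident-start {u = u} {w = w} J =
    trans (incident-joins J u) (cong (_∨ ⌊ u ≟ w ⌋) (⌊≟⌋-refl u))

  b2n-incident : Joins G e u w → ∀ x → b2n (incident G x e) ≡ b2n ⌊ x ≟ u ⌋ + b2n ⌊ x ≟ w ⌋
  b2n-incident {u = u} {w = w} J x = trans (cong b2n (incident-joins J x)) (b2n-∨ disjoint)
    where
    disjoint : ⌊ x ≟ u ⌋ ≡ true → ⌊ x ≟ w ⌋ ≡ false
    disjoint x≟u = ⌊≟⌋-≢ (joins-distinct J ∘ trans (sym (⌊≟⌋⇒≡ x≟u)))

  other-end : incident G y e ≡ true → ∃ λ x → Joins G e y x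
  other-end {y} {e} _  with y ≟ proj₁ (ends e) | y ≟ proj₂ (ends e)
  ... | yes y≡a | _       = proj₂ (ends e) , inj₁ (cong (_, proj₂ (ends e)) (sym y≡a))
  ... | no _    | yes y≡b = proj₁ (ends e) , inj₂ (cong (proj₁ (ends e) ,_) (sym y≡b))
  other-end () | no _ | no _

  count-endpoints : (e : Fin m) → count (λ v → incident G v e) ≡ 2
  count-endpoints e =
    trans (count-∨ _ _ disjoint)
          (cong₂ _+_ (count-≟ʳ (proj₁ (ends e))) (count-≟ʳ (proj₂ (ends e))))
    where
    disjoint : ∀ v → ⌊ v ≟ proj₁ (ends e) ⌋ ≡ true → ⌊ v ≟ proj₂ (ends e) ⌋ ≡ false
    disjoint v v≟a = ⌊≟⌋-≢ (noLoop e ∘ trans (sym (⌊≟⌋⇒≡ v≟a)))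

  handshake : sum (degree G) ≡ m * 2
  handshake = double-counting (incident G) count-endpoints

  minDegree⇒n*d≤m*2 : ∀ {d} → minDegreeAtLeast G d → n * d ≤ m * 2
  minDegree⇒n*d≤m*2 {d} δ≥d = begin
    n * d              ≡⟨ sum-const {n} d ⟨
    sum {n} (λ _ → d)  ≤⟨ sum-mono δ≥d ⟩
    sum (degree G)     ≡⟨ handshake ⟩
    m * 2              ∎
    where open ≤-Reasoning

  module _ {ℓ : ℕ} (c : Fin m → Fin ℓ) where

    ∑-colorCount : sum (colorCount G c) ≡ m
    ∑-colorCount =
      trans (double-counting (λ j e → ⌊ c e ≟ j ⌋) (λ e → count-≟ˡ (c e))) (*-identityʳ m)

    leastFrequent⇒ℓ*count≤m : ∀ {k} → LeastFrequent G c k → ℓ * colorCount G c k ≤ m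
    leastFrequent⇒ℓ*count≤m {k} rarest = begin
      ℓ * colorCount G c k               ≡⟨ sum-const {ℓ} _ ⟨
      sum {ℓ} (λ _ → colorCount G c k)   ≤⟨ sum-mono rarest ⟩
      sum (colorCount G c)               ≡⟨ ∑-colorCount ⟩
      m                                  ∎
      where open ≤-Reasoning

  degreeIn-mono : S ⊆ T → degreeIn G S v ≤ degreeIn G T v
  degreeIn-mono S⊆T = count-mono λ e h →
    let Se , ve = ∧-elim h in cong₂ _∧_ (S⊆T e Se) ve

  degreeIn-insert : (S : EdgeSet G) → S e ≡ false → ∀ v →
                    degreeIn G (insert e S) v ≡ b2n (incident G v e) + degreeIn G S v
  degreeIn-insert S Se v = count-insert-∧ {P = S} (incident G v) Se

  degreeIn-remove : (T : EdgeSet G) (v : Fin n) → T e ≡ true → incident G v e ≡ true →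
                    degreeIn G T v ≡ suc (degreeIn G (T ─ e) v)
  degreeIn-remove T v Te ve =
    trans (count-remove (λ i → T i ∧ incident G v i) (cong₂ _∧_ Te ve))
          (cong suc (count-cong λ i → xy∙z≈xz∙y (T i) (incident G v i) _))

  Leafless : EdgeSet G → Set
  Leafless T = ∀ v → degreeIn G T v ≢ 1

  CycleIn : EdgeSet G → Set
  CycleIn T = ∃ λ S → IsCycle G S × S ⊆ T

  CycleIn-mono : S ⊆ T → CycleIn S → CycleIn T
  CycleIn-mono S⊆T (C , cycle , C⊆S) = C , cycle , ⊆-trans C⊆S S⊆T

  _++_ : Walk G S u v → Walk G S v w → Walk G S u w
  here           ++ q = q
  step e Se J p ++ q = step e Se J (p ++ q)

  reverse : Walk G S u v → Walk G S v u
  reverse here           = here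
  reverse (step e Se J p) = reverse p ++ step e Se (Joins-sym J) here

  verticesOf : Walk G T u v → Fin n → Bool
  verticesOf {u = u} here x = ⌊ x ≟ u ⌋
  verticesOf (step {u} _ _ _ p) = insert u (verticesOf p)

  edgesOf : Walk G T u v → EdgeSet G
  edgesOf here           _ = false
  edgesOf (step e _ _ p)   = insert e (edgesOf p)

  IsPath : Walk G T u v → Set
  IsPath here               = ⊤
  IsPath (step {u} _ _ _ p) = verticesOf p u ≡ false × IsPath p

  edgesOf-⊆ : (p : Walk G T u v) → edgesOf p ⊆ T
  edgesOf-⊆ here _ ()
  edgesOf-⊆ (step e′ Te′ _ p) e h with e ≟ e′
  ... | yes refl = Te′
  ... | no _     = edgesOf-⊆ p e h

  start-on-walk : (p : Walk G T u v) → verticesOf p u ≡ true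
  start-on-walk {u = u} here = ⌊≟⌋-refl u
  start-on-walk {u = u} (step _ _ _ p) = insert-∋ u (verticesOf p)

  edge-off-walk : (p : Walk G T u v) → verticesOf p x ≡ false → incident G x e ≡ true →
                  edgesOf p e ≡ false
  edge-off-walk here _ _ = refl
  edge-off-walk {x = x} {e} (step {u} {z} e′ _ J p) x∉p xe with x ≟ u | e ≟ e′
  ... | no _   | no _     = edge-off-walk p x∉p xe
  ... | no x≢u | yes refl = case trans (sym xe) (incident-other x≢u x≢z) of λ ()
    where
    x≢z : x ≢ z
    x≢z refl = case trans (sym x∉p) (start-on-walk p) of λ ()
    incident-other : x ≢ u → x ≢ z → incident G x e ≡ false
    incident-other x≢u x≢z =
      trans (incident-joins J x) (cong₂ _∨_ (⌊≟⌋-≢ x≢u) (⌊≟⌋-≢ x≢z))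
  edge-off-walk (step _ _ _ _) () _ | yes _ | _

  walk-from : (p : Walk G T u v) → edgesOf p ⊆ S → verticesOf p x ≡ true → Walk G S x v
  walk-from {u = u} {x = x} here _ _ with x ≟ u
  ... | yes refl = here
  walk-from here _ () | no _
  walk-from {u = u} {x = x} (step e _ J p) p⊆S x∈p with x ≟ u
  ... | yes refl = step e (p⊆S e (insert-∋ e (edgesOf p))) J (walk-from p tail⊆S (start-on-walk p))
    where tail⊆S = ⊆-trans insert-⊇ p⊆S
  ... | no _     = walk-from p (⊆-trans insert-⊇ p⊆S) x∈p

  walk-to : (p : Walk G T u v) → IsPath p → verticesOf p x ≡ true →
            Σ (Walk G T u x) λ q → IsPath q × verticesOf q ⊆ verticesOf p
  walk-to {u = u} {x = x} here _ _ with x ≟ u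
  ... | yes refl = here , tt , λ _ y∈q → y∈q
  walk-to here _ () | no _
  walk-to {u = u} {x = x} (step e Te J p) (u∉p , p-path) x∈p with x ≟ u
  ... | yes refl = here , tt , λ y y≟x → cong (_∨ verticesOf p y) y≟x
  ... | no _ with walk-to p p-path x∈p
  ...   | q , q-path , q⊆p = step e Te J q , (⊆-false q⊆p u∉p , q-path) , insert-mono q⊆p

  path-degree : (p : Walk G T u v) → IsPath p → ∀ x →
                b2n ⌊ x ≟ u ⌋ + b2n ⌊ x ≟ v ⌋ + degreeIn G (edgesOf p) x ≡ 2 * b2n (verticesOf p x)
  path-degree {u = u} here _ x =
    trans (cong ([u] + [u] +_) (count-none {P = λ (_ : Fin m) → false} λ _ → refl)) (double [u])
    where
    [u] : ℕ
    [u] = b2n ⌊ x ≟ u ⌋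
    double : ∀ a → a + a + 0 ≡ 2 * a
    double = solve-∀
  path-degree {u = u} {v = v} (step {w = z} e Te J p) (u∉p , p-path) x = begin
    [u] + [v] + degreeIn G (insert e (edgesOf p)) x
      ≡⟨ cong ([u] + [v] +_) (degreeIn-insert (edgesOf p) e∉p x) ⟩
    [u] + [v] + (b2n (incident G x e) + deg)
      ≡⟨ cong (λ i → [u] + [v] + (i + deg)) (b2n-incident J x) ⟩
    [u] + [v] + ([u] + [z] + deg)
      ≡⟨ regroup [u] [v] [z] deg ⟩
    2 * [u] + ([z] + [v] + deg)
      ≡⟨ cong (2 * [u] +_) (path-degree p p-path x) ⟩
    2 * [u] + 2 * b2n (verticesOf p x)
      ≡⟨ *-distribˡ-+ 2 [u] _ ⟨
    2 * ([u] + b2n (verticesOf p x))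
      ≡⟨ cong (2 *_) (b2n-∨ x≟u⇒x∉p) ⟨
    2 * b2n (insert u (verticesOf p) x)
      ∎
    where
    open ≡-Reasoning
    [u] [v] [z] deg : ℕ
    [u] = b2n ⌊ x ≟ u ⌋
    [v] = b2n ⌊ x ≟ v ⌋
    [z] = b2n ⌊ x ≟ z ⌋
    deg = degreeIn G (edgesOf p) x
    regroup : ∀ a b c d → a + b + (a + c + d) ≡ 2 * a + (c + b + d)
    regroup = solve-∀
    e∉p : edgesOf p e ≡ false
    e∉p = edge-off-walk p u∉p (incident-start J)
    x≟u⇒x∉p : ⌊ x ≟ u ⌋ ≡ true → verticesOf p x ≡ false
    x≟u⇒x∉p x≟u = trans (cong (verticesOf p) (⌊≟⌋⇒≡ x≟u)) u∉p

  close-path : (q : Walk G T y x) → IsPath q → T e ≡ true → Joins G e y x → edgesOf q e ≡ false →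
               CycleIn T
  close-path {T} {y} {x} {e} q q-path Te J e∉q =
    C , ((e , insert-∋ e (edgesOf q)) , degree-0-or-2 , connected) , C⊆T
    where
    C : EdgeSet G
    C = insert e (edgesOf q)
    degree≡ : ∀ v → degreeIn G C v ≡ 2 * b2n (verticesOf q v)
    degree≡ v = begin
      degreeIn G C v                                          ≡⟨ degreeIn-insert (edgesOf q) e∉q v ⟩
      b2n (incident G v e) + degreeIn G (edgesOf q) v         ≡⟨ cong (_+ _) (b2n-incident J v) ⟩
      b2n ⌊ v ≟ y ⌋ + b2n ⌊ v ≟ x ⌋ + degreeIn G (edgesOf q) v ≡⟨ path-degree q q-path v ⟩
      2 * b2n (verticesOf q v)                                ∎
      where open ≡-Reasoning
    degree-0-or-2 : ∀ v → degreeIn G C v ≡ 0 ⊎ degreeIn G C v ≡ 2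
    degree-0-or-2 v with verticesOf q v | degree≡ v
    ... | true  | d≡2 = inj₂ d≡2
    ... | false | d≡0 = inj₁ d≡0
    on-q : ∀ v → degreeIn G C v ≢ 0 → verticesOf q v ≡ true
    on-q v d≢0 with verticesOf q v | degree≡ v
    ... | true  | _   = refl
    ... | false | d≡0 = ⊥-elim (d≢0 d≡0)
    connected : ∀ u v → degreeIn G C u ≢ 0 → degreeIn G C v ≢ 0 → Walk G C u v
    connected u v u-on v-on =
      walk-from q insert-⊇ (on-q u u-on) ++ reverse (walk-from q insert-⊇ (on-q v v-on))
    C⊆T : C ⊆ T
    C⊆T e′ h with e′ ≟ e
    ... | yes refl = Te
    ... | no _     = edgesOf-⊆ q e′ h

  another-edge : Leafless T → T e ≡ true → incident G y e ≡ true →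
                 ∃ λ e′ → e′ ≢ e × T e′ ≡ true × incident G y e′ ≡ true
  another-edge {T} {e} {y} leafless Te ye =
    let e′ , h       = count-witness λ d≡0 → leafless y (trans y-degree (cong suc d≡0))
        Te′─e , ye′ = ∧-elim h
        Te′ , e′≢e  = ─-elim {P = T} Te′─e
    in  e′ , e′≢e , Te′ , ye′
    where
    y-degree : degreeIn G T y ≡ suc (degreeIn G (T ─ e) y)
    y-degree = degreeIn-remove T y Te ye

  module _ {T : EdgeSet G} (leafless : Leafless T) where

    -- k is fuel: each step adds a fresh vertex, and a path has at most n of them.
    grow : ∀ k (e : Fin m) (Te : T e ≡ true) (J : Joins G e y z) (p : Walk G T z w) →
           IsPath (step e Te J p) → n < count (verticesOf (step e Te J p)) + k → CycleIn T
    grow zero e Te J p _ bound =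
      ⊥-elim (<⇒≱ bound (≤-trans (≤-reflexive (+-identityʳ _)) (count≤ _)))
    grow {y} (suc k) e Te J p path bound with another-edge {y = y} leafless Te (incident-start J)
    ... | e′ , e′≢e , Te′ , ye′ with other-end {y = y} ye′
    ... | x , J′ with verticesOf (step e Te J p) x in x∈?
    ... | false = grow k e′ Te′ (Joins-sym J′) (step e Te J p) (x∈? , path) bound′
      where
      bound′ : n < count (insert x (verticesOf (step e Te J p))) + k
      bound′ = subst (n <_) (trans (+-suc _ k) (cong (_+ k) (sym |x∷p|≡))) bound
        where |x∷p|≡ = count-insert (verticesOf (step e Te J p)) x∈?
    ... | true with walk-to p (proj₂ path) (insert⁻ {P = verticesOf p} (joins-distinct J′ ∘ sym) x∈?)
    ...   | q , q-path , q⊆p =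
      close-path (step e Te J q) (y∉q , q-path) Te′ J′
                 (cong₂ _∨_ (⌊≟⌋-≢ e′≢e) (edge-off-walk {x = y} q y∉q ye′))
      where
      y∉q : verticesOf q y ≡ false
      y∉q = ⊆-false q⊆p (proj₁ path)

    leafless-has-cycle : Nonempty T → CycleIn T
    leafless-has-cycle (e , Te) =
      grow (suc n) e Te J here (⌊≟⌋-≢ (joins-distinct J) , tt) (m≤n+m (suc n) _)
      where
      J : Joins G e (proj₁ (ends e)) (proj₂ (ends e))
      J = inj₁ refl

  active : EdgeSet G → Fin n → Bool
  active T v = 0 <ᵇ degreeIn G T v

  support : EdgeSet G → ℕ
  support T = count (active T)

  active-mono : S ⊆ T → active S ⊆ active T
  active-mono S⊆T v = 0<ᵇ-mono (degreeIn-mono {v = v} S⊆T)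

  support≥2 : Nonempty T → 2 ≤ support T
  support≥2 {T} (e , Te) =
    count-≥2 (active T) (endpoint-active J) (endpoint-active (Joins-sym J)) (joins-distinct J)
    where
    J : Joins G e (proj₁ (ends e)) (proj₂ (ends e))
    J = inj₁ refl
    endpoint-active : Joins G e u w → active T u ≡ true
    endpoint-active {u} J =
      0<⇒0<ᵇ (count-pos (λ i → T i ∧ incident G u i) (cong₂ _∧_ Te (incident-start J)))

  dense-has-cycle : (T : EdgeSet G) → Nonempty T → support T ≤ count T → CycleIn T
  dense-has-cycle T = peel T (<-wellFounded (count T))
    where
    peel : (T : EdgeSet G) → Acc _<_ (count T) → Nonempty T → support T ≤ count T → CycleIn T
    peel T (acc smaller) nonempty dense with any? (λ v → degreeIn G T v ≟ℕ 1)
    ... | no leafless = leafless-has-cycle (λ v d≡1 → leafless (v , d≡1)) nonempty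
    ... | yes (v , leaf)
      with count-witness {P = λ i → T i ∧ incident G v i} (λ d≡0 → case trans (sym d≡0) leaf of λ ())
    ...   | e , h = CycleIn-mono ─-⊆ (peel (T ─ e) (smaller fewer-edges) nonempty′ dense′)
      where
      Te : T e ≡ true
      Te = proj₁ (∧-elim h)
      ve : incident G v e ≡ true
      ve = proj₂ (∧-elim h)
      |T|≡ : count T ≡ suc (count (T ─ e))
      |T|≡ = count-remove T Te
      fewer-edges : count (T ─ e) < count T
      fewer-edges = ≤-reflexive (sym |T|≡)
      fewer-active : support (T ─ e) < support T
      fewer-active = count-< {j = v} (active-mono ─-⊆) (cong (0 <ᵇ_) v-isolated) (cong (0 <ᵇ_) leaf)
        where
        v-isolated : degreeIn G (T ─ e) v ≡ 0
        v-isolated = suc-injective (trans (sym (degreeIn-remove T v Te ve)) leaf)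
      dense′ : support (T ─ e) ≤ count (T ─ e)
      dense′ = ≤-pred (≤-trans fewer-active (≤-trans dense (≤-reflexive |T|≡)))
      nonempty′ : Nonempty (T ─ e)
      nonempty′ = count-witness λ |T─e|≡0 →
        let |T|≡1 = trans |T|≡ (cong suc |T─e|≡0)
        in  case ≤-trans (support≥2 nonempty) (≤-trans dense (≤-reflexive |T|≡1)) of λ { (s≤s ()) }

lemma3p1 : (G : Graph) → 1 ≤ Graph.n G → minDegreeAtLeast G 3
         → (ℓ : ℕ) → 3 ≤ ℓ → (c : Fin (Graph.m G) → Fin ℓ)
         → (k : Fin ℓ) → LeastFrequent G c k
         → ∃ λ S → IsCycle G S × Avoids G c S k
lemma3p1 G n≥1 δ≥3 ℓ ℓ≥3 c k rarest =
  let S , cycle , S⊆T = dense-has-cycle G T T-nonempty (≤-trans (count≤ (active G T)) n≤|T|)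
  in  S , cycle , λ e Se → T-avoids-k e (S⊆T e Se)
  where
  open Graph G
  T : EdgeSet G
  T e = not ⌊ c e ≟ k ⌋
  T-avoids-k : Avoids G c T k
  T-avoids-k e Te ce≡k with c e ≟ k
  ... | yes _    = case Te of λ ()
  ... | no ce≢k = ce≢k ce≡k
  n≤|T| : n ≤ count T
  n≤|T| = 3n≤2m⇒3c≤m⇒n≤m-c (minDegree⇒n*d≤m*2 G δ≥3)
            (≤-trans (*-monoˡ-≤ _ ℓ≥3) (leastFrequent⇒ℓ*count≤m G c rarest))
            (count-complement (λ e → ⌊ c e ≟ k ⌋))
  T-nonempty : Nonempty T
  T-nonempty = count-witness λ |T|≡0 → case ≤-trans n≥1 (subst (n ≤_) |T|≡0 n≤|T|) of λ ()
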